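{- For every agent $a$ and all $\phi,\psi,\chi\in\mathcal{L}_{ELKy^r}$, the following are theorems of $\mathbb{SKYR}$: (1) $\neg Ky_a^r(\phi,\psi)\to K_a\neg Ky_a^r(\phi,\psi)$; (2) $Ky_a^r(\bot,\phi)$; (3) $Ky_a^r(\phi,\psi\to\chi)\to(Ky_a^r(\phi,\psi)\to Ky_a^r(\phi,\chi))$.
   Context: $\mathcal{L}_{ELKy^r}$ is given by $\phi ::= p\mid\neg\phi\mid(\phi\land\phi)\mid K_a\phi\mid Ky_a^r(\phi,\phi)$ over a countably infinite set of atoms and a countable set of agents; $\to,\top,\bot$ defined as usual. $\Lambda\subseteq\mathcal{L}_{ELKy^r}$ is a fixed set (tautology ground). The Hilbert system $\mathbb{SKYR}$ has, for all agents $a$ and formulas: (PT) all classical propositional tautologies; (K) $K_a(\phi\to\psi)\to(K_a\phi\to K_a\psi)$; (T) $K_a\phi\to\phi$; (4) $K_a\phi\to K_aK_a\phi$; (5) $\neg K_a\phi\to K_a\neg K_a\phi$; (EKyR) $Ky_a^r(\chi,\phi\to\psi)\to(Ky_a^r(\theta,\phi)\to Ky_a^r(\chi\land\theta,\psi))$; (4YKR) $Ky_a^r(\phi,\psi)\to K_aKy_a^r(\phi,\psi)$; (DKyR) $Ky_a^r(\phi,\psi)\to K_a(\phi\to\psi)$; (IKyR) $Ky_a^r(\psi,\chi)\to(K_a(\phi\to\psi)\to Ky_a^r(\phi,\chi))$; (UKyR) $K_a\neg\phi\to Ky_a^r(\phi,\psi)$; rules (MP) from $\phi$ and $\phi\to\psi$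 infer $\psi$; (NK) from $\vdash\phi$ infer $\vdash K_a\phi$; (NKyR) from $\phi\in\Lambda$ infer $\vdash Ky_a^r(\top,\phi)$. -}

module Defs where

open import Data.Nat using (ℕ)
open import Data.Bool using (Bool; true; false; not; _∧_)
open import Relation.Binary.PropositionalEquality using (_≡_)

infix 8 ¬'_
infixl 6 _∧'_

data Form (Ag : Set) : Set where
  atom : ℕ → Form Ag
  ¬'_  : Form Ag → Form Ag
  _∧'_ : Form Ag → Form Ag → Form Ag
  K    : Ag → Form Ag → Form Ag
  Ky   : Ag → Form Ag → Form Ag → Form Ag

module _ {Ag : Set} where
  infixr 4 _⇒_
  _⇒_ : Form Ag → Form Ag → Form Ag
  φ ⇒ ψ = ¬' (φ ∧' ¬' ψ)

  ⊤' : Form Ag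
  ⊤' = ¬' (atom 0 ∧' ¬' atom 0)

  ⊥' : Form Ag
  ⊥' = ¬' ⊤'

  -- Propositional evaluation: modal subformulas (K, Ky) are treated as
  -- propositional letters, assigned truth values by v.
  eval : (Form Ag → Bool) → Form Ag → Bool
  eval v (atom p)  = v (atom p)
  eval v (¬' φ)    = not (eval v φ)
  eval v (φ ∧' ψ)  = eval v φ ∧ eval v ψ
  eval v (K a φ)   = v (K a φ)
  eval v (Ky a φ ψ) = v (Ky a φ ψ)

  Tautology : Form Ag → Set
  Tautology φ = (v : Form Ag → Bool) → eval v φ ≡ true

  data SKYR (Λ : Form Ag → Set) : Form Ag → Set where
    PT   : ∀ {φ} → Tautology φ → SKYR Λ φ
    AxK  : ∀ a φ ψ → SKYR Λ (K a (φ ⇒ ψ) ⇒ (K a φ ⇒ K a ψ))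
    AxT  : ∀ a φ → SKYR Λ (K a φ ⇒ φ)
    Ax4  : ∀ a φ → SKYR Λ (K a φ ⇒ K a (K a φ))
    Ax5  : ∀ a φ → SKYR Λ (¬' K a φ ⇒ K a (¬' K a φ))
    EKyR : ∀ a χ φ ψ θ →
           SKYR Λ (Ky a χ (φ ⇒ ψ) ⇒ (Ky a θ φ ⇒ Ky a (χ ∧' θ) ψ))
    4YKR : ∀ a φ ψ → SKYR Λ (Ky a φ ψ ⇒ K a (Ky a φ ψ))
    DKyR : ∀ a φ ψ → SKYR Λ (Ky a φ ψ ⇒ K a (φ ⇒ ψ))
    IKyR : ∀ a φ ψ χ → SKYR Λ (Ky a ψ χ ⇒ (K a (φ ⇒ ψ) ⇒ Ky a φ χ))
    UKyR : ∀ a φ ψ → SKYR Λ (K a (¬' φ) ⇒ Ky a φ ψ)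
    MP   : ∀ {φ ψ} → SKYR Λ φ → SKYR Λ (φ ⇒ ψ) → SKYR Λ ψ
    NK   : ∀ a {φ} → SKYR Λ φ → SKYR Λ (K a φ)
    NKyR : ∀ a {φ} → Λ φ → SKYR Λ (Ky a ⊤' φ)

module Submission where

-- Three modal facts then carry the theorem, each at its natural
-- generality:
--   * in S5, every provably positively introspective formula (⊢ Y → K_a Y)
--     is negatively introspective; (4YKR) makes Ky_a(φ, ψ) such a formula;
--   * Ky_a(φ, ψ) holds whenever ¬φ is provable (by (NK) and (UKyR));
--   * Ky_a(·, χ) is antitone along provable implications (by (NK), (IKyR)),
--     which turns the conclusion Ky_a(φ ∧ φ, χ) of (EKyR) into Ky_a(φ, χ).

open import Defs
open import Data.Bool using (Bool; true; false; not; _∧_)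
open import Data.Empty using (⊥-elim)
open import Data.Product using (_×_; _,_)
open import Relation.Nullary using (¬_)
open import Relation.Binary.PropositionalEquality using (_≡_; refl)

module Semantics {Ag : Set} (v : Form Ag → Bool) where

  -- A formula holds under the valuation v.  A record rather than a bare
  -- equation, so that the formula can be inferred from the hypotheses.
  record ⊨_ (A : Form Ag) : Set where
    constructor holds
    field truth : eval v A ≡ true
  open ⊨_ public

  ⇒-intro : ∀ {A B} → (⊨ A → ⊨ B) → ⊨ (A ⇒ B)
  ⇒-intro {A} {B} f = holds (implication (eval v A) (eval v B) λ x → truth (f (holds x)))
    where
    implication : ∀ x y → (x ≡ true → y ≡ true) → not (x ∧ not y) ≡ true
    implication false _    _ = refl
    implication true  true _ = refl
    implication true  false f with () ← f refl

  ⇒-elim : ∀ {A B} → ⊨ (A ⇒ B) → ⊨ A → ⊨ B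
  ⇒-elim {A} {B} (holds h) (holds a) = holds (modus-ponens (eval v A) (eval v B) h a)
    where
    modus-ponens : ∀ x y → not (x ∧ not y) ≡ true → x ≡ true → y ≡ true
    modus-ponens true true _ _ = refl

  ¬-intro : ∀ {A} → ¬ (⊨ A) → ⊨ (¬' A)
  ¬-intro {A} f = holds (negation (eval v A) λ x → f (holds x))
    where
    negation : ∀ x → ¬ (x ≡ true) → not x ≡ true
    negation false _ = refl
    negation true  f = ⊥-elim (f refl)

  ¬-elim : ∀ {A} → ⊨ (¬' A) → ¬ (⊨ A)
  ¬-elim {A} (holds h) (holds a) = contradiction (eval v A) h a
    where
    contradiction : ∀ x → not x ≡ true → ¬ (x ≡ true)
    contradiction true () _

  ∧-intro : ∀ {A B} → ⊨ A → ⊨ B → ⊨ (A ∧' B)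
  ∧-intro {A} {B} (holds a) (holds b) = holds (conjunction (eval v A) (eval v B) a b)
    where
    conjunction : ∀ x y → x ≡ true → y ≡ true → x ∧ y ≡ true
    conjunction true true _ _ = refl

  ∧-elimˡ : ∀ {A B} → ⊨ (A ∧' B) → ⊨ A
  ∧-elimˡ {A} {B} (holds h) = holds (left (eval v A) (eval v B) h)
    where
    left : ∀ x y → x ∧ y ≡ true → x ≡ true
    left true _ _ = refl

  ∧-elimʳ : ∀ {A B} → ⊨ (A ∧' B) → ⊨ B
  ∧-elimʳ {A} {B} (holds h) = holds (right (eval v A) (eval v B) h)
    where
    right : ∀ x y → x ∧ y ≡ true → y ≡ true
    right true true _ = refl

  ⊤-holds : ⊨ ⊤'
  ⊤-holds = ¬-intro λ p∧¬p → ¬-elim (∧-elimʳ p∧¬p) (∧-elimˡ p∧¬p)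

module _ {Ag : Set} {Λ : Form Ag → Set} where

  infix 2 ⊢_
  ⊢_ : Form Ag → Set
  ⊢ A = SKYR Λ A

  tautology : ∀ {A} → (∀ v → Semantics.⊨_ v A) → ⊢ A
  tautology holds-under = PT λ v → Semantics.truth (holds-under v)

  ⊢¬⊥ : ⊢ ¬' ⊥'
  ⊢¬⊥ = tautology λ v → let open Semantics v in ¬-intro λ ⊥ → ¬-elim ⊥ ⊤-holds

  ⊢duplicate : ∀ A → ⊢ A ⇒ A ∧' A
  ⊢duplicate A = tautology λ v → let open Semantics v in ⇒-intro λ a → ∧-intro a a

  ⇒-trans : ∀ {A B C} → ⊢ A ⇒ B → ⊢ B ⇒ C → ⊢ A ⇒ C
  ⇒-trans {A} {B} {C} ab bc = MP bc (MP ab syllogism)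
    where
    syllogism : ⊢ ((A ⇒ B) ⇒ (B ⇒ C) ⇒ (A ⇒ C))
    syllogism = tautology λ v → let open Semantics v in
      ⇒-intro λ ab → ⇒-intro λ bc → ⇒-intro λ a → ⇒-elim bc (⇒-elim ab a)

  contrapose : ∀ {A B} → ⊢ A ⇒ B → ⊢ ¬' B ⇒ ¬' A
  contrapose {A} {B} ab = MP ab contraposition
    where
    contraposition : ⊢ ((A ⇒ B) ⇒ (¬' B ⇒ ¬' A))
    contraposition = tautology λ v → let open Semantics v in
      ⇒-intro λ ab → ⇒-intro λ ¬b → ¬-intro λ a → ¬-elim ¬b (⇒-elim ab a)

  discharge : ∀ {A B C} → ⊢ A ⇒ (B ⇒ C) → ⊢ B → ⊢ A ⇒ C
  discharge {A} {B} {C} abc b = MP b (MP abc exchange)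
    where
    exchange : ⊢ ((A ⇒ (B ⇒ C)) ⇒ (B ⇒ (A ⇒ C)))
    exchange = tautology λ v → let open Semantics v in
      ⇒-intro λ abc → ⇒-intro λ b → ⇒-intro λ a → ⇒-elim (⇒-elim abc a) b

  weaken-conclusion : ∀ {A B C D} → ⊢ A ⇒ (B ⇒ C) → ⊢ C ⇒ D → ⊢ A ⇒ (B ⇒ D)
  weaken-conclusion {A} {B} {C} {D} abc cd = MP abc (MP cd weakening)
    where
    weakening : ⊢ ((C ⇒ D) ⇒ (A ⇒ (B ⇒ C)) ⇒ (A ⇒ (B ⇒ D)))
    weakening = tautology λ v → let open Semantics v in
      ⇒-intro λ cd → ⇒-intro λ abc → ⇒-intro λ a → ⇒-intro λ b →
        ⇒-elim cd (⇒-elim (⇒-elim abc a) b)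

  K-mono : ∀ a {A B} → ⊢ A ⇒ B → ⊢ K a A ⇒ K a B
  K-mono a {A} {B} ab = MP (NK a ab) (AxK a A B)

  -- In S5, a provably positively introspective formula is also negatively
  -- introspective:  ¬Y → ¬K Y → K ¬K Y → K ¬Y  by (T), (5) and K-mono.
  negative-introspection : ∀ a {Y} → ⊢ Y ⇒ K a Y → ⊢ ¬' Y ⇒ K a (¬' Y)
  negative-introspection a {Y} Y⇒KY =
    ⇒-trans (contrapose (AxT a Y)) (⇒-trans (Ax5 a Y) (K-mono a (contrapose Y⇒KY)))

  Ky-refuted : ∀ a {φ} ψ → ⊢ ¬' φ → ⊢ Ky a φ ψ
  Ky-refuted a {φ} ψ ¬φ = MP (NK a ¬φ) (UKyR a φ ψ)

  Ky-strengthen : ∀ a {φ θ} χ → ⊢ φ ⇒ θ → ⊢ Ky a θ χ ⇒ Ky a φ χ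
  Ky-strengthen a {φ} {θ} χ φ⇒θ = discharge (IKyR a φ θ χ) (NK a φ⇒θ)

  -- Ky_a(φ, ·) is closed under modus ponens: (EKyR) yields Ky_a(φ ∧ φ, χ),
  -- and φ → φ ∧ φ brings the antecedent back to φ.
  Ky-modus-ponens : ∀ a φ ψ χ → ⊢ Ky a φ (ψ ⇒ χ) ⇒ (Ky a φ ψ ⇒ Ky a φ χ)
  Ky-modus-ponens a φ ψ χ =
    weaken-conclusion (EKyR a φ ψ χ φ) (Ky-strengthen a χ (⊢duplicate φ))

proposition3p7 : {Ag : Set} (Λ : Form Ag → Set) (a : Ag) (φ ψ χ : Form Ag) →
    SKYR Λ (¬' Ky a φ ψ ⇒ K a (¬' Ky a φ ψ))
    × SKYR Λ (Ky a ⊥' φ)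
    × SKYR Λ (Ky a φ (ψ ⇒ χ) ⇒ (Ky a φ ψ ⇒ Ky a φ χ))
proposition3p7 Λ a φ ψ χ =
    negative-introspection a (4YKR a φ ψ)
  , Ky-refuted a φ ⊢¬⊥
  , Ky-modus-ponens a φ ψ χ
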